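{- Let $G$ and $H$ be connected graphs with vertex degrees bounded above by a constant $\delta$. Let $\phi\colon G\to H$ and $\psi\colon H\to G$ be $c$-quasi-isometries, where $c$ is a positive integer, such that $\mathrm{dist}_G(u,\psi\phi u)\le c$ for every vertex $u$ of $G$. Let $\{f_k\}_{k\ge1}$ be a sequence of positive integers. If $G$ has the finite-step $\{f_k\}_{k\ge1}$-retaining property, then $H$ has the finite-step $\{b_k\}_{k\ge1}$-retaining property, where \[ b_k=\left(f_{2c(k-1)+1}+f_{2c(k-1)+2}+\cdots+f_{2ck}\right)\delta^{c^2+2c+1}.\]
   Context: Graphs carry the path-metric on their vertex sets. A map $\phi\colon X\to Y$ of metric spaces is a $c$-quasi-isometry if $\frac1c d_X(x_1,x_2)-c\le d_Y(\phi x_1,\phi x_2)\le c\,d_X(x_1,x_2)+c$ for all $x_1,x_2$ and every point of $Y$ is within distance $c$ of the image. Growth: for non-decreasing $f,g\colon\mathbb N\to\mathbb N$, $f\preceq g$ means there is an integer $C>0$ with $f(n)\le Cg(Cn+C)+C$ for all $n$, and $f\sim g$ means both $f\preceq g$ and $g\preceq f$; for a set $Y$ of vertices with the restricted path-metric and nonempty finite $A\subseteq Y$, $\beta_{Y,A}(n)=|\{y\in Y:\mathrm{dist}(A,y)\le n\}|$, and $\mathsf{Growth}(Y)$ is its $\sim$-class. Fire game (reach $1$): an $\{f_k\}$-strategy is a sequence $\{W_k\}_{k\ge1}$ of vertex sets with $|W_k|\le f_k$; for a finite initial fire $X_0$, for $k>0$ the set $X_k$ consists of vertices connected to a vertex of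 $X_{k-1}$ by a path of length at most $1$ containing no vertex of $(W_1\cup\cdots\cup W_k)\setminus X_{k-1}$. The strategy is retaining for $X_0$ if $U=V(G)\setminus\bigcup_kX_k$ has $\mathsf{Growth}(U)=\mathsf{Growth}(G)$; it is a finite-step retaining strategy if moreover $W_k=\emptyset$ for all sufficiently large $k$. A graph has the finite-step $\{f_k\}$-retaining property if every finite set of vertices $X_0$ admits a finite-step retaining $\{f_k\}$-strategy. -}

module Defs where

open import Data.Nat using (ℕ; zero; suc; _+_; _*_; _∸_; _^_; _≤_; _<_)
open import Data.List using (List; []; length; map; upTo)
open import Data.Nat.ListAction using (sum)
open import Data.List.Membership.Propositional using (_∈_)
open import Data.List.Relation.Unary.All using (All)
open import Data.List.Relation.Unary.Unique.Propositional using (Unique)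
open import Data.Product using (Σ; ∃; _×_; _,_)
open import Data.Sum using (_⊎_)
open import Data.Unit using (⊤)
open import Relation.Nullary using (¬_)
open import Relation.Binary.PropositionalEquality using (_≡_; _≢_)
open import Function.Bundles using (_⇔_)

record Graph : Set₁ where
  field
    V      : Set
    E      : V → V → Set
    E-sym  : ∀ {x y} → E x y → E y x
    E-irr  : ∀ {x} → ¬ E x x
open Graph public

_≼_ : (ℕ → ℕ) → (ℕ → ℕ) → Set
f ≼ g = ∃ λ C → 0 < C × (∀ n → f n ≤ C * g (C * n + C) + C)

_∼_ : (ℕ → ℕ) → (ℕ → ℕ) → Set
f ∼ g = f ≼ g × g ≼ f

module _ (G : Graph) where

  -- Reach P x y n : there is a walk of length ≤ n from x to y all of whose
  -- vertices satisfy P, i.e. dist_Y(x,y) ≤ n for the restricted path-metric on Y = {v | P v}.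
  data Reach (P : V G → Set) : V G → V G → ℕ → Set where
    here : ∀ {x n} → P x → Reach P x x n
    step : ∀ {x z y n} → P x → E G x z → Reach P z y n → Reach P x y (suc n)

  Everywhere : V G → Set
  Everywhere _ = ⊤

  Dist≤ : V G → V G → ℕ → Set
  Dist≤ x y n = Reach Everywhere x y n

  Connected : Set
  Connected = ∀ x y → ∃ λ n → Dist≤ x y n

  DegreeBounded : ℕ → Set
  DegreeBounded δ = ∀ v (L : List (V G)) → Unique L → All (E G v) L → length L ≤ δ

  InBall : (V G → Set) → List (V G) → ℕ → V G → Set
  InBall P A n y = P y × ∃ λ a → a ∈ A × Reach P a y n

  HasCard : (V G → Set) → ℕ → Set
  HasCard Q k = Σ (List (V G)) λ L → Unique L × length L ≡ k × (∀ y → Q y ⇔ y ∈ L)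

  IsBallCount : (V G → Set) → List (V G) → (ℕ → ℕ) → Set
  IsBallCount P A β = ∀ n → HasCard (InBall P A n) (β n)

  SameGrowthAsGraph : (V G → Set) → Set
  SameGrowthAsGraph P =
    Σ (List (V G)) λ A → A ≢ [] × All P A ×
    Σ (List (V G)) λ A' → A' ≢ [] ×
    Σ (ℕ → ℕ) λ β → Σ (ℕ → ℕ) λ β' →
      IsBallCount P A β × IsBallCount Everywhere A' β' × β ∼ β'

  -- Fire game with reach 1.  W k (k ≥ 1) is the k-th protected set; W 0 is unused.
  Protected : (ℕ → List (V G)) → ℕ → V G → Set
  Protected W k v = ∃ λ i → 1 ≤ i × i ≤ k × v ∈ W i

  Fire : List (V G) → (ℕ → List (V G)) → ℕ → V G → Set
  Fire X₀ W zero v = v ∈ X₀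
  Fire X₀ W (suc k) v =
    ∃ λ u → Fire X₀ W k u × (u ≡ v ⊎ E G u v)
      × ¬ (Protected W (suc k) u × ¬ Fire X₀ W k u)
      × ¬ (Protected W (suc k) v × ¬ Fire X₀ W k v)

  Unburnt : List (V G) → (ℕ → List (V G)) → V G → Set
  Unburnt X₀ W v = ¬ (∃ λ k → Fire X₀ W k v)

  IsStrategy : (ℕ → ℕ) → (ℕ → List (V G)) → Set
  IsStrategy f W = ∀ k → 1 ≤ k → length (W k) ≤ f k

  Retaining : List (V G) → (ℕ → List (V G)) → Set
  Retaining X₀ W = SameGrowthAsGraph (Unburnt X₀ W)

  FiniteStep : (ℕ → List (V G)) → Set
  FiniteStep W = ∃ λ N → ∀ k → N ≤ k → W k ≡ []

  FiniteStepRetainingProperty : (ℕ → ℕ) → Set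
  FiniteStepRetainingProperty f =
    ∀ (X₀ : List (V G)) → ∃ λ W → IsStrategy f W × Retaining X₀ W × FiniteStep W

-- φ : X → Y is a c-quasi-isometry (inequalities stated for the integer-valued path metrics;
-- (1/c) d_X - c ≤ d_Y  ⇔  d_X ≤ c d_Y + c²)
record QuasiIsometry (X Y : Graph) (c : ℕ) (φ : V X → V Y) : Set where
  field
    upper : ∀ x₁ x₂ n → Dist≤ X x₁ x₂ n → Dist≤ Y (φ x₁) (φ x₂) (c * n + c)
    lower : ∀ x₁ x₂ m → Dist≤ Y (φ x₁) (φ x₂) m → Dist≤ X x₁ x₂ (c * m + c * c)
    dense : ∀ y → ∃ λ x → Dist≤ Y (φ x) y c

bSeq : (ℕ → ℕ) → ℕ → ℕ → ℕ → ℕ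
bSeq f c δ k = sum (map (λ j → f (2 * c * (k ∸ 1) + suc j)) (upTo (2 * c))) * δ ^ (c * c + 2 * c + 1)

module Submission where

-- Given X₀ ⊆ H, let G play a finite-step retaining strategy W against ψ(X₀). In round b+1,
-- H protects the ψ-preimages of the (2c−1)-balls around everything W protects in rounds
-- 2cb+1, …, 2cb+2c. An edge of H maps under ψ to a walk of length at most 2c, so if v burns in H
-- at time k then ψ v burns in G at time 2ck, and v stays unburnt whenever ψ v does. Preimages of
-- points lie in balls of radius c², which gives the bound b_k.
--
-- Only finitely many vertices of G are ever protected. If an unburnt vertex x is far from all of
-- them, the whole 2c-ball around φ x stays unburnt in H. Hence φ maps an unburnt G-ball of radius m
-- around A, minus a finite set, into an unburnt H-ball of radius 2cm. Since fibres of φ and ψ have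
-- bounded size, Growth(U_H) ≽ Growth(U_G) ∼ Growth(G) ≽ Growth(H). G is infinite, so these balls
-- are not empty. Excluded middle turns sets of bounded size into explicit lists.

open import Defs
open import Level using (0ℓ)
open import Axiom.ExcludedMiddle using (ExcludedMiddle)
open import Data.Nat
  using (ℕ; zero; suc; pred; _+_; _*_; _^_; _≤_; _<_; _≤′_; ≤′-refl; ≤′-step; z≤n; s≤s; _≤?_; _<?_;
         NonZero; >-nonZero)
open import Data.Nat.Properties
open import Data.Nat.DivMod using (_/_; _%_; m≡m%n+[m/n]*n; m%n<n; m<n*o⇒m/o<n)
open import Data.Nat.Tactic.RingSolver using (solve-∀)
open import Data.Nat.ListAction using (sum)
open import Data.List using (List; []; _∷_; [_]; _++_; length; map; upTo; concatMap; filter; deduplicate)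
open import Data.List.Properties using (length-++; length-removeAt′)
open import Data.List.Membership.Propositional using (_∈_; lose)
open import Data.List.Membership.Propositional.Properties
  using (∈-concatMap⁺; ∈-upTo⁺; ∈-map⁺; ∈-++⁺ˡ; ∈-++⁺ʳ; ∈-filter⁺; ∈-filter⁻; ∈-deduplicate⁺; ∈-deduplicate⁻)
open import Data.List.Relation.Unary.Any using (here; there; _─_)
open import Data.List.Relation.Unary.All as All using (All; []; _∷_)
open import Data.List.Relation.Unary.All.Properties using (¬Any⇒All¬; all-filter; map⁺)
open import Data.List.Relation.Unary.AllPairs using ([]; _∷_)
open import Data.List.Relation.Unary.Unique.Propositional using (Unique)
open import Data.List.Relation.Unary.Unique.DecPropositional.Properties using (deduplicate-!)
open import Data.Product using (∃; _×_; _,_; proj₁; proj₂)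
open import Data.Sum using (_⊎_; inj₁; inj₂)
open import Relation.Nullary using (¬_; yes; no; contradiction)
open import Relation.Binary.Core using (_Preserves_⟶_)
open import Relation.Binary.PropositionalEquality using (_≡_; _≢_; refl; sym; trans; cong; subst)
open import Function.Base using (_∘′_)
open import Function.Bundles using (mk⇔; Equivalence)

module _ {A : Set} where

  ∈-─⁺ : ∀ {x y} {xs : List A} (x∈xs : x ∈ xs) → y ∈ xs → y ≢ x → y ∈ (xs ─ x∈xs)
  ∈-─⁺ (here refl)  (here refl)  y≢x = contradiction refl y≢x
  ∈-─⁺ (here refl)  (there y∈xs) _   = y∈xs
  ∈-─⁺ (there _)    (here refl)  _   = here refl
  ∈-─⁺ (there x∈xs) (there y∈xs) y≢x = there (∈-─⁺ x∈xs y∈xs y≢x)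

  Unique⊆⇒length≤ : ∀ {xs ys : List A} → Unique xs → (∀ {x} → x ∈ xs → x ∈ ys) → length xs ≤ length ys
  Unique⊆⇒length≤ {[]}          _          _     = z≤n
  Unique⊆⇒length≤ {x ∷ xs} {ys} (x∉xs ∷ u) xs⊆ys = begin
    suc (length xs)          ≤⟨ s≤s (Unique⊆⇒length≤ u xs⊆ys─x) ⟩
    suc (length (ys ─ x∈ys)) ≡⟨ length-removeAt′ ys _ ⟨
    length ys                ∎
    where
    open ≤-Reasoning
    x∈ys = xs⊆ys (here refl)
    xs⊆ys─x : ∀ {y} → y ∈ xs → y ∈ (ys ─ x∈ys)
    xs⊆ys─x y∈xs = ∈-─⁺ x∈ys (xs⊆ys (there y∈xs)) λ { refl → All.lookup x∉xs y∈xs refl }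

  ∈-concatMap⁺′ : ∀ {B : Set} {g : B → List A} {b bs x} → b ∈ bs → x ∈ g b → x ∈ concatMap g bs
  ∈-concatMap⁺′ {g = g} b∈bs x∈gb = ∈-concatMap⁺ g (lose b∈bs x∈gb)

  length-concatMap≤ : ∀ {B : Set} (g : B → List A) {h : B → ℕ} →
                      (∀ b → length (g b) ≤ h b) → ∀ bs → length (concatMap g bs) ≤ sum (map h bs)
  length-concatMap≤ g bound []       = z≤n
  length-concatMap≤ g bound (b ∷ bs) = begin
    length (g b ++ concatMap g bs)         ≡⟨ length-++ (g b) ⟩
    length (g b) + length (concatMap g bs) ≤⟨ +-mono-≤ (bound b) (length-concatMap≤ g bound bs) ⟩
    _                                      ∎
    where open ≤-Reasoning

  length-concatMap≤length* : ∀ {B : Set} (g : B → List A) {K} →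
                             (∀ b → length (g b) ≤ K) → ∀ bs → length (concatMap g bs) ≤ length bs * K
  length-concatMap≤length* g bound []       = z≤n
  length-concatMap≤length* g bound (b ∷ bs) = begin
    length (g b ++ concatMap g bs)         ≡⟨ length-++ (g b) ⟩
    length (g b) + length (concatMap g bs) ≤⟨ +-mono-≤ (bound b) (length-concatMap≤length* g bound bs) ⟩
    _                                      ∎
    where open ≤-Reasoning

  concatMap-[] : ∀ {B : Set} {g : B → List A} → (∀ b → g b ≡ []) → ∀ bs → concatMap g bs ≡ []
  concatMap-[] g≡[] []       = refl
  concatMap-[] g≡[] (b ∷ bs) rewrite g≡[] b = concatMap-[] g≡[] bs

sum-map-*ʳ : ∀ {B : Set} (g : B → ℕ) K bs → sum (map (λ b → g b * K) bs) ≡ sum (map g bs) * K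
sum-map-*ʳ g K []       = refl
sum-map-*ʳ g K (b ∷ bs) = trans (cong (g b * K +_) (sum-map-*ʳ g K bs)) (sym (*-distribʳ-+ K (g b) _))

∈⇒≤sum : ∀ {B : Set} (g : B → ℕ) {b bs} → b ∈ bs → g b ≤ sum (map g bs)
∈⇒≤sum g {bs = b ∷ _}  (here refl)  = m≤m+n (g b) _
∈⇒≤sum g {bs = b′ ∷ _} (there b∈bs) = ≤-trans (∈⇒≤sum g b∈bs) (m≤n+m _ (g b′))

Bounded : (ℕ → ℕ) → Set
Bounded f = ∃ λ B → ∀ n → f n ≤ B

≼-intro : ∀ {f g} → g Preserves _≤_ ⟶ _≤_ → (e a b d : ℕ) →
          (∀ n → f n ≤ e + g (b * n + d) * a) → f ≼ g
≼-intro {f} {g} g-mono e a b d bound = C , s≤s z≤n , λ n → begin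
  f n                   ≤⟨ bound n ⟩
  e + g (b * n + d) * a ≤⟨ +-mono-≤ e≤C (*-mono-≤ (g-mono (+-mono-≤ (*-monoˡ-≤ n b≤C) d≤C)) a≤C) ⟩
  C + g (C * n + C) * C ≡⟨ +-comm C _ ⟩
  g (C * n + C) * C + C ≡⟨ cong (_+ C) (*-comm _ C) ⟩
  C * g (C * n + C) + C ∎
  where
  open ≤-Reasoning
  C = suc (e + a + b + d)
  e≤C : e ≤ C
  e≤C = m≤n⇒m≤1+n (≤-trans (m≤m+n e a) (≤-trans (m≤m+n _ b) (m≤m+n _ d)))
  a≤C : a ≤ C
  a≤C = m≤n⇒m≤1+n (≤-trans (m≤n+m a e) (≤-trans (m≤m+n _ b) (m≤m+n _ d)))
  b≤C : b ≤ C
  b≤C = m≤n⇒m≤1+n (≤-trans (m≤n+m b (e + a)) (m≤m+n _ d))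
  d≤C : d ≤ C
  d≤C = m≤n⇒m≤1+n (m≤n+m d _)

≤⇒≼ : ∀ {f g} → g Preserves _≤_ ⟶ _≤_ → (∀ n → f n ≤ g n) → f ≼ g
≤⇒≼ {f} {g} g-mono f≤g = ≼-intro g-mono 0 1 1 0 λ n → begin
  f n               ≤⟨ f≤g n ⟩
  g n               ≤⟨ g-mono (≤-reflexive (sym (trans (+-identityʳ (1 * n)) (*-identityˡ n)))) ⟩
  g (1 * n + 0)     ≡⟨ *-identityʳ _ ⟨
  g (1 * n + 0) * 1 ∎
  where open ≤-Reasoning

≼-trans : ∀ {f g h} → h Preserves _≤_ ⟶ _≤_ → f ≼ g → g ≼ h → f ≼ h
≼-trans {f} {g} {h} h-mono (C , _ , f≤g) (C′ , _ , g≤h) =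
  ≼-intro h-mono (C * C′ + C) (C * C′) (C′ * C) (C′ * C + C′) λ n → begin
    f n                                                    ≤⟨ f≤g n ⟩
    C * g (C * n + C) + C                                  ≤⟨ +-monoˡ-≤ C (*-monoʳ-≤ C (g≤h _)) ⟩
    C * (C′ * h (C′ * (C * n + C) + C′) + C′) + C          ≡⟨ regroup C C′ (h _) ⟩
    C * C′ + C + h (C′ * (C * n + C) + C′) * (C * C′)      ≡⟨ cong (λ m → C * C′ + C + h m * (C * C′))
                                                                   (expand C C′ n) ⟩
    C * C′ + C + h (C′ * C * n + (C′ * C + C′)) * (C * C′) ∎
  where
  open ≤-Reasoning
  regroup : ∀ C C′ x → C * (C′ * x + C′) + C ≡ C * C′ + C + x * (C * C′)
  regroup = solve-∀
  expand : ∀ C C′ n → C′ * (C * n + C) + C′ ≡ C′ * C * n + (C′ * C + C′)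
  expand = solve-∀

≼-bounded : ∀ {f g} → f ≼ g → Bounded g → Bounded f
≼-bounded (C , _ , f≤g) (B , g≤B) = C * B + C , λ n → ≤-trans (f≤g n) (+-monoˡ-≤ C (*-monoʳ-≤ C (g≤B _)))

Finite : Graph → Set
Finite G = ∃ λ (L : List (V G)) → ∀ v → v ∈ L

module _ (G : Graph) where

  reach-mono : ∀ {P x y m n} → Reach G P x y m → m ≤ n → Reach G P x y n
  reach-mono (here px)     _         = here px
  reach-mono (step px e r) (s≤s m≤n) = step px e (reach-mono r m≤n)

  reach-map : ∀ {P Q : V G → Set} → (∀ {x} → P x → Q x) → ∀ {x y n} → Reach G P x y n → Reach G Q x y n
  reach-map P⇒Q (here px)     = here (P⇒Q px)
  reach-map P⇒Q (step px e r) = step (P⇒Q px) e (reach-map P⇒Q r)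

  reach⇒dist : ∀ {P x y n} → Reach G P x y n → Dist≤ G x y n
  reach⇒dist = reach-map _

  reach-trans : ∀ {P x y z m n} → Reach G P x y m → Reach G P y z n → Reach G P x z (m + n)
  reach-trans {m = m} {n} (here _) r′ = reach-mono r′ (m≤n+m n m)
  reach-trans (step px e r)        r′ = step px e (reach-trans r r′)

  dist-edge : ∀ {x y} → E G x y → Dist≤ G x y 1
  dist-edge e = step _ e (here _)

  dist-snoc : ∀ {x y z n} → Dist≤ G x y n → E G y z → Dist≤ G x z (suc n)
  dist-snoc {n = n} d e = subst (Dist≤ G _ _) (+-comm n 1) (reach-trans d (dist-edge e))

  dist-sym : ∀ {x y n} → Dist≤ G x y n → Dist≤ G y x n
  dist-sym (here _)     = here _
  dist-sym (step _ e d) = dist-snoc (dist-sym d) (E-sym G e)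

  dist⇒reach : ∀ {P : V G → Set} {x y n} → Dist≤ G x y n → (∀ q → Dist≤ G x q n → P q) → Reach G P x y n
  dist⇒reach (here _)     P-ball = here (P-ball _ (here _))
  dist⇒reach (step _ e d) P-ball = step (P-ball _ (here _)) e (dist⇒reach d λ q d′ → P-ball q (step _ e d′))

  closed-under-walks : ∀ {Q : V G → Set} → (∀ {y z} → Q y → E G y z → Q z) →
                       ∀ {x y n} → Q x → Dist≤ G x y n → Q y
  closed-under-walks closed qx (here _)     = qx
  closed-under-walks closed qx (step _ e d) = closed-under-walks closed (closed qx e) d

  card≤length : ∀ {Q k} → HasCard G Q k → (L : List (V G)) → (∀ y → Q y → y ∈ L) → k ≤ length L
  card≤length (L′ , u , refl , Q⇔L′) L Q⊆L =
    Unique⊆⇒length≤ u λ y∈L′ → Q⊆L _ (Equivalence.from (Q⇔L′ _) y∈L′)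

  card-mono : ∀ {Q Q′ k k′} → HasCard G Q k → HasCard G Q′ k′ → (∀ y → Q y → Q′ y) → k ≤ k′
  card-mono card (L′ , _ , refl , Q′⇔L′) Q⊆Q′ =
    card≤length card L′ λ y qy → Equivalence.to (Q′⇔L′ y) (Q⊆Q′ y qy)

  card-pos : ∀ {Q k z} → HasCard G Q k → Q z → 0 < k
  card-pos ([]    , _ , refl , Q⇔L) qz = contradiction (Equivalence.to (Q⇔L _) qz) λ ()
  card-pos (_ ∷ _ , _ , refl , _)   _  = s≤s z≤n

  card-< : ∀ {Q Q′ k k′ z} → HasCard G Q k → HasCard G Q′ k′ → (∀ y → Q y → Q′ y) → Q′ z → ¬ Q z → k < k′
  card-< {z = z} (L , u , refl , Q⇔L) (L′ , _ , refl , Q′⇔L′) Q⊆Q′ q′z ¬qz =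
    Unique⊆⇒length≤ (¬Any⇒All¬ L (¬qz ∘′ Equivalence.from (Q⇔L z)) ∷ u) z∷L⊆L′
    where
    z∷L⊆L′ : ∀ {y} → y ∈ z ∷ L → y ∈ L′
    z∷L⊆L′ (here refl) = Equivalence.to (Q′⇔L′ z) q′z
    z∷L⊆L′ (there y∈L) = Equivalence.to (Q′⇔L′ _) (Q⊆Q′ _ (Equivalence.from (Q⇔L _) y∈L))

  ballCount-mono : ∀ {P A β} → IsBallCount G P A β → β Preserves _≤_ ⟶ _≤_
  ballCount-mono count m≤n =
    card-mono (count _) (count _) λ { _ (py , a , a∈A , r) → py , a , a∈A , reach-mono r m≤n }

  retaining⇒infinite : ∀ {f} → FiniteStepRetainingProperty G f → ¬ Finite G
  retaining⇒infinite ret (L , every) with ret L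
  ... | _ , _ , ([]    , A≢[] , _)             , _ = A≢[] refl
  ... | _ , _ , (a ∷ _ , _    , unburnt ∷ _ , _) , _ = unburnt (0 , every a)

module _ {G : Graph} {X₀ : List (V G)} {W : ℕ → List (V G)} where

  fire-suc : ∀ {k v} → Fire G X₀ W k v → Fire G X₀ W (suc k) v
  fire-suc burning = _ , burning , inj₁ refl , (λ (_ , unburnt) → unburnt burning) , (λ (_ , unburnt) → unburnt burning)

  fire-mono : ∀ {k k′ v} → k ≤ k′ → Fire G X₀ W k v → Fire G X₀ W k′ v
  fire-mono k≤k′ = go (≤⇒≤′ k≤k′)
    where
    go : ∀ {k k′ v} → k ≤′ k′ → Fire G X₀ W k v → Fire G X₀ W k′ v
    go ≤′-refl        burning = burning
    go (≤′-step k≤k′) burning = fire-suc (go k≤k′ burning)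

  protected-mono : ∀ {k k′ v} → k ≤ k′ → Protected G W k v → Protected G W k′ v
  protected-mono k≤k′ (i , 1≤i , i≤k , v∈Wi) = i , 1≤i , ≤-trans i≤k k≤k′ , v∈Wi

  Unprotected : V G → Set
  Unprotected v = ∀ k → ¬ Protected G W k v

  unburnt-spreads : ∀ {x y n} → Unburnt G X₀ W x → (∀ q → Dist≤ G x q n → Unprotected q) →
                    Dist≤ G x y n → Unburnt G X₀ W y
  unburnt-spreads unburnt safe (here _) = unburnt
  unburnt-spreads {x} unburnt safe (step {z = z} _ e d) =
    unburnt-spreads z-unburnt (λ q d′ → safe q (step _ e d′)) d
    where
    z-unburnt : Unburnt G X₀ W z
    z-unburnt (t , z-burning) =
      unburnt (suc t , z , z-burning , inj₂ (E-sym G e) , (λ (_ , z-unburnt) → z-unburnt z-burning) ,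
               (λ (x-protected , _) → safe x (here _) (suc t) x-protected))

  fire-spreads : ∀ {x y n r t T} → Dist≤ G x y n → n ≤ suc r →
                 (∀ z → Dist≤ G z y r → ¬ Protected G W T z) →
                 Fire G X₀ W t x → t + n ≤ T → Fire G X₀ W T y
  fire-spreads {n = n} {t = t} (here _) _ _ burning t+n≤T = fire-mono (≤-trans (m≤m+n t n) t+n≤T) burning
  fire-spreads {n = suc n} {t = t} {T} (step {z = z} _ e d) (s≤s n≤r) safe burning t+n≤T =
    fire-spreads d (m≤n⇒m≤1+n n≤r) safe z-burning 1+t+n≤T
    where
    1+t+n≤T : suc t + n ≤ T
    1+t+n≤T = subst (_≤ T) (+-suc t n) t+n≤T
    z-burning : Fire G X₀ W (suc t) z
    z-burning = _ , burning , inj₂ e , (λ (_ , unburnt) → unburnt burning) ,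
                (λ (z-protected , _) → safe z (reach-mono G d n≤r)
                  (protected-mono (≤-trans (s≤s (m≤m+n t n)) 1+t+n≤T) z-protected))

ballSize : ℕ → ℕ → ℕ
ballSize δ zero    = 1
ballSize δ (suc r) = suc (δ * ballSize δ r)

ballSize<^ : ∀ {δ} → 2 ≤ δ → ∀ r → ballSize δ r < δ ^ suc r
ballSize<^ {δ} 2≤δ zero    = subst (2 ≤_) (sym (*-identityʳ δ)) 2≤δ
ballSize<^ {δ} 2≤δ (suc r) = begin-strict
  suc (δ * ballSize δ r) <⟨ +-monoˡ-≤ (δ * ballSize δ r) 2≤δ ⟩
  δ + δ * ballSize δ r   ≡⟨ *-suc δ (ballSize δ r) ⟨
  δ * suc (ballSize δ r) ≤⟨ *-monoʳ-≤ δ (ballSize<^ 2≤δ r) ⟩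
  δ * δ ^ suc r          ∎
  where open ≤-Reasoning

qi-edge : ∀ {X Y c φ} → QuasiIsometry X Y c φ → ∀ {x y} → E X x y → Dist≤ Y (φ x) (φ y) (2 * c)
qi-edge {Y = Y} {c} qφ e =
  reach-mono Y (QuasiIsometry.upper qφ _ _ 1 (dist-edge _ e)) (≤-reflexive (c*1+c≡2*c c))
  where
  c*1+c≡2*c : ∀ c → c * 1 + c ≡ 2 * c
  c*1+c≡2*c = solve-∀

module _ (em : ExcludedMiddle 0ℓ) where

  bounded⇒enumerable : ∀ {A : Set} {P : A → Set} n → (∀ L → Unique L → All P L → length L ≤ n) →
                       ∃ λ L → Unique L × All P L × (∀ x → P x → x ∈ L)
  bounded⇒enumerable {P = P} n bound with em {∃ λ L → Unique L × All P L × length L ≡ n}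
  ... | yes (L , u , pL , refl) = L , u , pL , complete
    where
    complete : ∀ x → P x → x ∈ L
    complete x px with em {x ∈ L}
    ... | yes x∈L = x∈L
    ... | no  x∉L = contradiction (bound (x ∷ L) (¬Any⇒All¬ L x∉L ∷ u) (px ∷ pL)) 1+n≰n
  bounded⇒enumerable zero    _     | no ∄L = contradiction ([] , [] , [] , refl) ∄L
  bounded⇒enumerable (suc n) bound | no ∄L =
    bounded⇒enumerable n λ L u pL → m<1+n⇒m≤n (≤∧≢⇒< (bound L u pL) λ len≡ → ∄L (L , u , pL , len≡))

  hasCard : ∀ {G} (Q : V G → Set) (L : List (V G)) → (∀ y → Q y → y ∈ L) → ∃ (HasCard G Q)
  hasCard Q L Q⊆L = length L′ , L′ , deduplicate-! _≈?_ (filter Q? L) , refl , λ y → mk⇔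
      (λ qy → ∈-deduplicate⁺ _≈?_ (∈-filter⁺ Q? (Q⊆L y qy) qy))
      (λ y∈L′ → proj₂ (∈-filter⁻ Q? {xs = L} (∈-deduplicate⁻ _≈?_ (filter Q? L) y∈L′)))
    where
    Q? = λ x → em {Q x}
    _≈?_ = λ (x y : _) → em {x ≡ y}
    L′ = deduplicate _≈?_ (filter Q? L)

  ballCount-infinite : ∀ {G A β a} → Connected G → ¬ Finite G → a ∈ A →
                       IsBallCount G (Everywhere G) A β → ∀ n → n < β n
  ballCount-infinite {G} {a = a} _ _ a∈A count zero = card-pos G (count 0) (_ , a , a∈A , here _)
  ballCount-infinite {G} {A} {a = a} conn infinite a∈A count (suc n)
    with em {∃ λ y → ∃ λ z → InBall G (Everywhere G) A n y × E G y z × ¬ InBall G (Everywhere G) A n z}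
  ... | yes (y , z , (_ , b , b∈A , d) , e , z∉) =
    ≤-trans (s≤s (ballCount-infinite conn infinite a∈A count n))
      (card-< G (count n) (count (suc n)) grow (_ , b , b∈A , dist-snoc G d e) z∉)
    where
    grow : ∀ y → InBall G (Everywhere G) A n y → InBall G (Everywhere G) A (suc n) y
    grow _ (_ , b′ , b′∈A , d′) = _ , b′ , b′∈A , reach-mono G d′ (n≤1+n n)
  ... | no no-boundary = contradiction (L , λ v → Equivalence.to (Ball⇔L v) (∈Ball v)) infinite
    where
    L = proj₁ (count n)
    Ball⇔L = proj₂ (proj₂ (proj₂ (count n)))
    closed : ∀ {y z} → InBall G (Everywhere G) A n y → E G y z → InBall G (Everywhere G) A n z
    closed {y} {z} y∈ e with em {InBall G (Everywhere G) A n z}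
    ... | yes z∈ = z∈
    ... | no  z∉ = contradiction (y , z , y∈ , e , z∉) no-boundary
    ∈Ball : ∀ v → InBall G (Everywhere G) A n v
    ∈Ball v = closed-under-walks G closed (_ , a , a∈A , here _) (proj₂ (conn a v))

  module BoundedDegree {G : Graph} {δ : ℕ} (deg : DegreeBounded G δ) where

    private
      neighbourhood : ∀ v → ∃ λ L → Unique L × All (E G v) L × (∀ w → E G v w → w ∈ L)
      neighbourhood v = bounded⇒enumerable δ (deg v)

    neighbours : V G → List (V G)
    neighbours v = proj₁ (neighbourhood v)

    length-neighbours≤ : ∀ v → length (neighbours v) ≤ δ
    length-neighbours≤ v with _ , u , adj , _ ← neighbourhood v = deg v _ u adj

    neighbours-adjacent : ∀ v → All (E G v) (neighbours v)
    neighbours-adjacent v = proj₁ (proj₂ (proj₂ (neighbourhood v)))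

    ∈-neighbours : ∀ {v w} → E G v w → w ∈ neighbours v
    ∈-neighbours {v} e = proj₂ (proj₂ (proj₂ (neighbourhood v))) _ e

    ball : ℕ → V G → List (V G)
    ball zero    v = [ v ]
    ball (suc r) v = v ∷ concatMap (ball r) (neighbours v)

    length-ball≤ : ∀ r v → length (ball r v) ≤ ballSize δ r
    length-ball≤ zero    v = ≤-refl
    length-ball≤ (suc r) v = s≤s (begin
      length (concatMap (ball r) (neighbours v)) ≤⟨ length-concatMap≤length* (ball r) (length-ball≤ r) (neighbours v) ⟩
      length (neighbours v) * ballSize δ r       ≤⟨ *-monoˡ-≤ (ballSize δ r) (length-neighbours≤ v) ⟩
      δ * ballSize δ r                           ∎)
      where open ≤-Reasoning

    ∈-ball : ∀ {v y r} → Dist≤ G v y r → y ∈ ball r v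
    ∈-ball {r = zero}  (here _)     = here refl
    ∈-ball {r = suc r} (here _)     = here refl
    ∈-ball             (step _ e d) = there (∈-concatMap⁺′ (∈-neighbours e) (∈-ball d))

    ballCount : (P : V G → Set) (A : List (V G)) → ∃ (IsBallCount G P A)
    ballCount P A = (λ n → proj₁ (count n)) , (λ n → proj₂ (count n))
      where
      count : ∀ n → ∃ (HasCard G (InBall G P A n))
      count n = hasCard {G} (InBall G P A n) (concatMap (ball n) A)
                  λ { _ (_ , a , a∈A , r) → ∈-concatMap⁺′ a∈A (∈-ball (reach⇒dist G r)) }

    degree≤1⇒finite : Connected G → δ ≤ 1 → Finite G
    degree≤1⇒finite conn δ≤1 with em {V G}
    ... | no  ∄v = [] , λ v → contradiction v ∄v
    ... | yes v  = v ∷ neighbours v , λ w → closed-under-walks G star-closed (here refl) (proj₂ (conn v w))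
      where
      star-closed : ∀ {y z} → y ∈ v ∷ neighbours v → E G y z → z ∈ v ∷ neighbours v
      star-closed (here refl) e = there (∈-neighbours e)
      star-closed {y} {z} (there y∈N) e with em {z ≡ v}
      ... | yes refl = here refl
      ... | no  z≢v  = contradiction (≤-trans (deg y (z ∷ v ∷ []) ((z≢v ∷ []) ∷ [] ∷ []) z,v-adjacent) δ≤1) 1+n≰n
        where
        z,v-adjacent : All (E G y) (z ∷ v ∷ [])
        z,v-adjacent = e ∷ E-sym G (All.lookup (neighbours-adjacent v) y∈N) ∷ []

  module Fibres {X Y : Graph} {δ c : ℕ} (degX : DegreeBounded X δ)
                {φ : V X → V Y} (qφ : QuasiIsometry X Y c φ) where

    open BoundedDegree {X} degX

    -- By the lower quasi-isometry bound, all of φ⁻¹(p) lies within c·c of any one of its points.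
    fibre : V Y → List (V X)
    fibre p with em {∃ λ x → φ x ≡ p}
    ... | yes (x , _) = ball (c * c) x
    ... | no  _       = []

    ∈-fibre : ∀ x → x ∈ fibre (φ x)
    ∈-fibre x with em {∃ λ x′ → φ x′ ≡ φ x}
    ... | no  ∄x′           = contradiction (x , refl) ∄x′
    ... | yes (x′ , φx′≡φx) =
      ∈-ball (reach-mono X (QuasiIsometry.lower qφ x′ x 0 φx′~φx) (≤-reflexive (cong (_+ c * c) (*-zeroʳ c))))
      where
      φx′~φx : Dist≤ Y (φ x′) (φ x) 0
      φx′~φx = subst (λ y → Dist≤ Y (φ x′) y 0) φx′≡φx (here _)

    length-fibre≤ : ∀ p → length (fibre p) ≤ ballSize δ (c * c)
    length-fibre≤ p with em {∃ λ x → φ x ≡ p}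
    ... | yes (x , _) = length-ball≤ (c * c) x
    ... | no  _       = z≤n

    card≤-fibred : ∀ {Q Q′ k k′} (L : List (V X)) → HasCard X Q k → HasCard Y Q′ k′ →
                   (∀ x → Q x → x ∈ L ⊎ Q′ (φ x)) → k ≤ length L + k′ * ballSize δ (c * c)
    card≤-fibred L card (L′ , _ , refl , Q′⇔L′) Q⊆L∪φ⁻¹Q′ = begin
      _                                         ≤⟨ card≤length X card (L ++ concatMap fibre L′) cover ⟩
      length (L ++ concatMap fibre L′)          ≡⟨ length-++ L ⟩
      length L + length (concatMap fibre L′)    ≤⟨ +-monoʳ-≤ (length L)
                                                     (length-concatMap≤length* fibre length-fibre≤ L′) ⟩
      length L + length L′ * ballSize δ (c * c) ∎
      where
      open ≤-Reasoning
      cover : ∀ x → _ → x ∈ L ++ concatMap fibre L′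
      cover x qx with Q⊆L∪φ⁻¹Q′ x qx
      ... | inj₁ x∈L  = ∈-++⁺ˡ x∈L
      ... | inj₂ q′φx = ∈-++⁺ʳ L (∈-concatMap⁺′ (Equivalence.to (Q′⇔L′ (φ x)) q′φx) (∈-fibre x))

  module StrategyTransfer {G H : Graph} {δ c : ℕ} (c≥1 : 1 ≤ c)
                          (degG : DegreeBounded G δ) (degH : DegreeBounded H δ)
                          {ψ : V H → V G} (qψ : QuasiIsometry H G c ψ) (W : ℕ → List (V G)) where

    open BoundedDegree {G} degG using (ball; ∈-ball; length-ball≤)
    open Fibres degH qψ using (fibre; ∈-fibre; length-fibre≤)

    private instance
      c≢0 : NonZero c
      c≢0 = >-nonZero c≥1
      2c≢0 : NonZero (2 * c)
      2c≢0 = m*n≢0 2 c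

    radius : ℕ
    radius = pred (2 * c)

    guarded : List (V G) → List (V H)
    guarded Z = concatMap (λ w → concatMap fibre (ball radius w)) Z

    ∈-guarded : ∀ {z Z v} → z ∈ Z → Dist≤ G z (ψ v) radius → v ∈ guarded Z
    ∈-guarded {v = v} z∈Z d = ∈-concatMap⁺′ z∈Z (∈-concatMap⁺′ (∈-ball d) (∈-fibre v))

    K : ℕ
    K = ballSize δ radius * ballSize δ (c * c)

    length-guarded≤ : ∀ Z → length (guarded Z) ≤ length Z * K
    length-guarded≤ = length-concatMap≤length* _ λ w → begin
      length (concatMap fibre (ball radius w))    ≤⟨ length-concatMap≤length* fibre length-fibre≤ (ball radius w) ⟩
      length (ball radius w) * ballSize δ (c * c) ≤⟨ *-monoˡ-≤ _ (length-ball≤ radius w) ⟩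
      K                                           ∎
      where open ≤-Reasoning

    K≤δ^ : 2 ≤ δ → K ≤ δ ^ (c * c + 2 * c + 1)
    K≤δ^ 2≤δ = begin
      ballSize δ radius * ballSize δ (c * c)
        ≤⟨ *-mono-≤ (<⇒≤ (ballSize<^ 2≤δ radius)) (<⇒≤ (ballSize<^ 2≤δ (c * c))) ⟩
      δ ^ suc radius * δ ^ suc (c * c) ≡⟨ ^-distribˡ-+-* δ (suc radius) _ ⟨
      δ ^ (suc radius + suc (c * c))   ≡⟨ cong (λ e → δ ^ (e + suc (c * c))) (suc-pred (2 * c)) ⟩
      δ ^ (2 * c + suc (c * c))        ≡⟨ cong (δ ^_) (exponent c) ⟩
      δ ^ (c * c + 2 * c + 1)          ∎
      where
      open ≤-Reasoning
      exponent : ∀ c → 2 * c + suc (c * c) ≡ c * c + 2 * c + 1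
      exponent = solve-∀

    -- One round of H answers 2c rounds of G, because ψ stretches an edge of H to at most 2c edges.
    W′ : ℕ → List (V H)
    W′ zero    = []
    W′ (suc b) = concatMap (λ i → guarded (W (2 * c * b + suc i))) (upTo (2 * c))

    W′-isStrategy : ∀ {f} → IsStrategy G f W → 2 ≤ δ → IsStrategy H (bSeq f c δ) W′
    W′-isStrategy {f} W-isStrategy 2≤δ (suc b) _ = begin
      length (W′ (suc b))                          ≤⟨ length-concatMap≤ _ guarded≤ (upTo (2 * c)) ⟩
      sum (map (λ i → f (j i) * K) (upTo (2 * c))) ≡⟨ sum-map-*ʳ (f ∘′ j) K (upTo (2 * c)) ⟩
      sum (map (f ∘′ j) (upTo (2 * c))) * K        ≤⟨ *-monoʳ-≤ (sum (map (f ∘′ j) (upTo (2 * c)))) (K≤δ^ 2≤δ) ⟩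
      bSeq f c δ (suc b)                           ∎
      where
      open ≤-Reasoning
      j : ℕ → ℕ
      j i = 2 * c * b + suc i
      guarded≤ : ∀ i → length (guarded (W (j i))) ≤ f (j i) * K
      guarded≤ i = ≤-trans (length-guarded≤ (W (j i)))
                           (*-monoˡ-≤ K (W-isStrategy (j i) (≤-trans (s≤s z≤n) (m≤n+m _ _))))

    W′-finiteStep : FiniteStep G W → FiniteStep H W′
    W′-finiteStep (N , W≡[]) = N , W′≡[]
      where
      W′≡[] : ∀ k → N ≤ k → W′ k ≡ []
      W′≡[] zero    _     = refl
      W′≡[] (suc b) N≤1+b = concatMap-[] (λ i → cong guarded (W≡[] _ (≤-trans N≤1+b (1+b≤ i)))) (upTo (2 * c))
        where
        1+b≤ : ∀ i → suc b ≤ 2 * c * b + suc i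
        1+b≤ i = subst (suc b ≤_) (sym (+-suc _ i)) (s≤s (≤-trans (m≤n*m b (2 * c)) (m≤m+n _ i)))

    W′-protected : ∀ {k z v} → Protected G W (2 * c * k) z → Dist≤ G z (ψ v) radius → Protected H W′ k v
    W′-protected {k} {z} (suc j , _ , j<2ck , z∈Wj) d = suc b , s≤s z≤n , b<k , v∈W′
      where
      b = j / (2 * c)
      i = j % (2 * c)
      b<k : b < k
      b<k = m<n*o⇒m/o<n (subst (j <_) (*-comm (2 * c) k) j<2ck)
      j≡ : 2 * c * b + suc i ≡ suc j
      j≡ = trans (regroup (2 * c) b i) (cong suc (sym (m≡m%n+[m/n]*n j (2 * c))))
        where
        regroup : ∀ m b i → m * b + suc i ≡ suc (i + b * m)
        regroup = solve-∀
      v∈W′ = ∈-concatMap⁺′ (∈-upTo⁺ (m%n<n j (2 * c))) (∈-guarded (subst (λ t → z ∈ W t) (sym j≡) z∈Wj) d)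

    fire-transfer : ∀ {X₀ k v} → Fire H X₀ W′ k v → Fire G (map ψ X₀) W (2 * c * k) (ψ v)
    fire-transfer {X₀} {zero} {v} v∈X₀ =
      subst (λ t → Fire G (map ψ X₀) W t (ψ v)) (sym (*-zeroʳ (2 * c))) (∈-map⁺ ψ v∈X₀)
    fire-transfer {X₀} {suc k} {v} (u , u-burning , u≡v⊎u~v , _ , v-unguarded) with em {Fire H X₀ W′ k v}
    ... | yes v-burning = fire-mono (*-monoʳ-≤ (2 * c) (n≤1+n k)) (fire-transfer v-burning)
    ... | no  v-unburnt with u≡v⊎u~v
    ...   | inj₁ refl = contradiction u-burning v-unburnt
    ...   | inj₂ u~v  = fire-spreads (qi-edge qψ u~v) (≤-reflexive (sym (suc-pred (2 * c)))) safe
                          (fire-transfer u-burning) (≤-reflexive (trans (+-comm _ (2 * c)) (sym (*-suc (2 * c) k))))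
      where
      safe : ∀ z → Dist≤ G z (ψ v) radius → ¬ Protected G W (2 * c * suc k) z
      safe z d z-protected = v-unguarded (W′-protected z-protected d , v-unburnt)

    unburnt-transfer : ∀ {X₀ v} → Unburnt G (map ψ X₀) W (ψ v) → Unburnt H X₀ W′ v
    unburnt-transfer ψv-unburnt (k , v-burning) = ψv-unburnt (2 * c * k , fire-transfer v-burning)

  module GrowthTransfer {G H : Graph} {δ c : ℕ} (c≥1 : 1 ≤ c)
      (degG : DegreeBounded G δ) (degH : DegreeBounded H δ)
      {φ : V G → V H} {ψ : V H → V G} (qφ : QuasiIsometry G H c φ) (qψ : QuasiIsometry H G c ψ)
      (ψφ-close : ∀ u → Dist≤ G u (ψ (φ u)) c) (conn : Connected G) (infinite : ¬ Finite G)
      (X₀ : List (V H)) (W : ℕ → List (V G)) (N : ℕ) (W≡[] : ∀ k → N ≤ k → W k ≡ [])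
      {A A′ : List (V G)} {a′ : V G} (a′∈A′ : a′ ∈ A′) {β β′ : ℕ → ℕ}
      (countA : IsBallCount G (Unburnt G (map ψ X₀) W) A β) (countA′ : IsBallCount G (Everywhere G) A′ β′)
      (β∼β′ : β ∼ β′) where

    open StrategyTransfer c≥1 degG degH qψ W using (W′; unburnt-transfer)
    private
      module BG = BoundedDegree {G} degG
      module BH = BoundedDegree {H} degH
      module Fφ = Fibres degG qφ
      module Fψ = Fibres degH qψ

    UG : V G → Set
    UG = Unburnt G (map ψ X₀) W

    UH : V H → Set
    UH = Unburnt H X₀ W′

    protectedList : List (V G)
    protectedList = concatMap W (upTo N)

    ∈-protectedList : ∀ {k w} → Protected G W k w → w ∈ protectedList
    ∈-protectedList {w = w} (j , _ , _ , w∈Wj) with j <? N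
    ... | yes j<N = ∈-concatMap⁺′ (∈-upTo⁺ j<N) w∈Wj
    ... | no  j≮N = contradiction (subst (w ∈_) (W≡[] j (≮⇒≥ j≮N)) w∈Wj) λ ()

    -- dist_H(φ x, q) ≤ D gives dist_G(x, ψ q) ≤ R, via ψφ-close and the upper bound for ψ.
    D R : ℕ
    D = 2 * c
    R = c + (c * D + c)

    Near Remote : V G → Set
    Near y = ∃ λ w → Dist≤ G y w R × ∃ λ k → Protected G W k w
    Remote y = ¬ Near y × UG y

    -- A walk in U_G enters the remote region for the last time at its start or at a neighbour of a
    -- near vertex; entryList contains all such neighbours.
    nearList entryList : List (V G)
    nearList  = concatMap (BG.ball R) protectedList
    entryList = concatMap (BG.ball (suc R)) protectedList

    ∈-nearList : ∀ {y} → Near y → y ∈ nearList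
    ∈-nearList (w , d , _ , w-protected) = ∈-concatMap⁺′ (∈-protectedList w-protected) (BG.∈-ball (dist-sym G d))

    ∈-entryList : ∀ {x z} → Near x → E G x z → z ∈ entryList
    ∈-entryList (w , d , _ , w-protected) e =
      ∈-concatMap⁺′ (∈-protectedList w-protected) (BG.∈-ball (dist-snoc G (dist-sym G d) e))

    remote-image-ball : ∀ {x q} → Remote x → Dist≤ H (φ x) q D → UH q
    remote-image-ball {x} (x-far , x-unburnt) d = unburnt-transfer
      (unburnt-spreads x-unburnt (λ q′ d′ k q′-protected → x-far (q′ , d′ , k , q′-protected))
        (reach-trans G (ψφ-close x) (QuasiIsometry.upper qψ _ _ D d)))

    remote-edge-image : ∀ {x z} → Remote x → E G x z → Reach H UH (φ x) (φ z) D
    remote-edge-image x-remote e = dist⇒reach H (qi-edge qφ e) λ _ → remote-image-ball x-remote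

    remote-walk : ∀ {x y n} → Reach G UG x y n → ¬ Near y →
                  ∃ λ z → z ∈ x ∷ entryList × Remote z × Reach H UH (φ z) (φ y) (n * D)
    remote-walk (here y-unburnt) y-far =
      _ , here refl , (y-far , y-unburnt) , here (remote-image-ball (y-far , y-unburnt) (here _))
    remote-walk {n = suc n} (step {x} x-unburnt e r) y-far with remote-walk r y-far
    ... | z , there z∈entry , z-remote , walk = z , there z∈entry , z-remote , reach-mono H walk (m≤n+m _ D)
    ... | z , here refl     , z-remote , walk with em {Near x}
    ...   | yes x-near = z , there (∈-entryList x-near e) , z-remote , reach-mono H walk (m≤n+m _ D)
    ...   | no  x-far  =
      x , here refl , (x-far , x-unburnt) , reach-trans H (remote-edge-image (x-far , x-unburnt) e) walk

    AH : List (V H)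
    AH = map φ (filter (λ x → em {Remote x}) (A ++ entryList))

    AH-unburnt : All UH AH
    AH-unburnt = map⁺ (All.map (λ x-remote → remote-image-ball x-remote (here _)) (all-filter _ (A ++ entryList)))

    remote-inBall : ∀ {m y} → InBall G UG A m y → ¬ Near y → InBall H UH AH (m * D) (φ y)
    remote-inBall (y-unburnt , a , a∈A , r) y-far with remote-walk r y-far
    ... | z , z∈ , z-remote , walk =
      remote-image-ball (y-far , y-unburnt) (here _) , φ z , ∈-map⁺ φ (∈-filter⁺ _ (source z∈) z-remote) , walk
      where
      source : ∀ {z} → z ∈ a ∷ entryList → z ∈ A ++ entryList
      source (here refl)     = ∈-++⁺ˡ a∈A
      source (there z∈entry) = ∈-++⁺ʳ A z∈entry

    βH β′H : ℕ → ℕ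
    βH  = proj₁ (BH.ballCount UH AH)
    β′H = proj₁ (BH.ballCount (Everywhere H) AH)

    countH : IsBallCount H UH AH βH
    countH = proj₂ (BH.ballCount UH AH)

    countH′ : IsBallCount H (Everywhere H) AH β′H
    countH′ = proj₂ (BH.ballCount (Everywhere H) AH)

    β≼βH : β ≼ βH
    β≼βH = ≼-intro (ballCount-mono H countH) (length nearList) (ballSize δ (c * c)) D 0 λ m → begin
      β m                                                   ≤⟨ Fφ.card≤-fibred nearList (countA m) (countH (m * D))
                                                                 cover ⟩
      length nearList + βH (m * D) * ballSize δ (c * c)     ≡⟨ cong (λ r → length nearList + βH r * ballSize δ (c * c))
                                                                 (m*D≡D*m+0 m D) ⟩
      length nearList + βH (D * m + 0) * ballSize δ (c * c) ∎
      where
      open ≤-Reasoning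
      m*D≡D*m+0 : ∀ m D → m * D ≡ D * m + 0
      m*D≡D*m+0 = solve-∀
      cover : ∀ {m} y → InBall G UG A m y → y ∈ nearList ⊎ InBall H UH AH (m * D) (φ y)
      cover y y∈ with em {Near y}
      ... | yes y-near = inj₁ (∈-nearList y-near)
      ... | no  y-far  = inj₂ (remote-inBall y∈ y-far)

    β′H≼β′ : β′H ≼ β′
    β′H≼β′ = ≼-intro (ballCount-mono G countA′) 0 (ballSize δ (c * c)) c (D₀ + c) λ n →
      Fψ.card≤-fibred [] (countH′ n) (countA′ (c * n + (D₀ + c))) λ { y (_ , a , a∈AH , r) →
        inj₂ (_ , a′ , a′∈A′ , reach-mono G (reach-trans G (proj₂ (conn a′ (ψ a))) (QuasiIsometry.upper qψ a y n r))
                                            (radius≤ a∈AH)) }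
      where
      dist₀ : V H → ℕ
      dist₀ a = proj₁ (conn a′ (ψ a))
      D₀ = sum (map dist₀ AH)
      radius≤ : ∀ {a n} → a ∈ AH → dist₀ a + (c * n + c) ≤ c * n + (D₀ + c)
      radius≤ {a} {n} a∈AH = ≤-trans (+-monoˡ-≤ _ (∈⇒≤sum dist₀ a∈AH)) (≤-reflexive (swap D₀ (c * n) c))
        where
        swap : ∀ x y z → x + (y + z) ≡ y + (x + z)
        swap = solve-∀

    AH≢[] : AH ≢ []
    AH≢[] AH≡[] = ≤⇒≯ (β′≤B B) (ballCount-infinite conn infinite a′∈A′ countA′ B)
      where
      βH≤0 : ∀ n → βH n ≤ 0
      βH≤0 n = card≤length H (countH n) [] λ { _ (_ , a , a∈AH , _) → contradiction (subst (a ∈_) AH≡[] a∈AH) λ () }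
      β′-bounded : Bounded β′
      β′-bounded = ≼-bounded (proj₂ β∼β′) (≼-bounded β≼βH (0 , βH≤0))
      B = proj₁ β′-bounded
      β′≤B = proj₂ β′-bounded

    βH∼β′H : βH ∼ β′H
    βH∼β′H = ≤⇒≼ (ballCount-mono H countH′) βH≤β′H
           , ≼-trans βH-mono β′H≼β′ (≼-trans βH-mono (proj₂ β∼β′) β≼βH)
      where
      βH-mono = ballCount-mono H countH
      βH≤β′H : ∀ n → βH n ≤ β′H n
      βH≤β′H n = card-mono H (countH n) (countH′ n) λ { _ (_ , a , a∈AH , r) → _ , a , a∈AH , reach⇒dist H r }

    retaining : Retaining H X₀ W′
    retaining = AH , AH≢[] , AH-unburnt , AH , AH≢[] , βH , β′H , countH , countH′ , βH∼β′H

  retaining-transfer : ∀ {G H δ c φ ψ} (c≥1 : 1 ≤ c) (degG : DegreeBounded G δ) (degH : DegreeBounded H δ) →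
    QuasiIsometry G H c φ → (qψ : QuasiIsometry H G c ψ) → (∀ u → Dist≤ G u (ψ (φ u)) c) →
    Connected G → ¬ Finite G → ∀ X₀ W → FiniteStep G W → Retaining G (map ψ X₀) W →
    Retaining H X₀ (StrategyTransfer.W′ c≥1 degG degH qψ W)
  retaining-transfer _ _ _ _ _ _ _ _ _ _ _ (_ , _ , _ , [] , A′≢[] , _) = contradiction refl A′≢[]
  retaining-transfer c≥1 degG degH qφ qψ ψφ-close conn infinite X₀ W (N , W≡[])
                     (_ , _ , _ , _ ∷ _ , _ , _ , _ , countA , countA′ , β∼β′) =
    GrowthTransfer.retaining c≥1 degG degH qφ qψ ψφ-close conn infinite X₀ W N W≡[] (here refl) countA countA′ β∼β′

-- The case δ ≤ 1 is vacuous because G is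
-- infinite; δ ≥ 2 is what makes ballSize δ r < δ ^ (r + 1).
corollary4p5 : ExcludedMiddle 0ℓ →
    (G H : Graph) (δ c : ℕ) → 1 ≤ c →
    Connected G → Connected H → DegreeBounded G δ → DegreeBounded H δ →
    (φ : V G → V H) (ψ : V H → V G) →
    QuasiIsometry G H c φ → QuasiIsometry H G c ψ →
    (∀ u → Dist≤ G u (ψ (φ u)) c) →
    (f : ℕ → ℕ) → (∀ k → 1 ≤ k → 1 ≤ f k) →
    FiniteStepRetainingProperty G f →
    FiniteStepRetainingProperty H (bSeq f c δ)
corollary4p5 em G H δ c c≥1 conn _ degG degH φ ψ qφ qψ ψφ-close f _ G-retaining X₀
  with G-retaining (map ψ X₀) | δ ≤? 1
... | _ | yes δ≤1 = contradiction (BoundedDegree.degree≤1⇒finite em degG conn δ≤1) G-infinite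
  where G-infinite = retaining⇒infinite G G-retaining
... | W , W-isStrategy , W-retaining , W-finiteStep | no δ≰1 =
  W′ , W′-isStrategy W-isStrategy (≰⇒> δ≰1) ,
  retaining-transfer em c≥1 degG degH qφ qψ ψφ-close conn G-infinite X₀ W W-finiteStep W-retaining ,
  W′-finiteStep W-finiteStep
  where
  G-infinite = retaining⇒infinite G G-retaining
  open StrategyTransfer em c≥1 degG degH qψ W
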